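{- Let $G$ be a finite simple connected graph with $\omega(G)\ge 2$ that contains no induced subgraph isomorphic to $P_5$ or to $K_1+2K_2$. Then $\chi(G)\le \frac{3}{2}\left(\omega^2(G)-\omega(G)\right)$.
   Context: $P_5$ is the path on 5 vertices, $K_t$ the complete graph on $t$ vertices. For disjoint graphs $F_1,F_2$, $F_1\cup F_2$ is their disjoint union, $kF$ is the disjoint union of $k$ copies of $F$, and $F_1+F_2$ is the join (disjoint union plus all edges between $V(F_1)$ and $V(F_2)$). Thus $K_1+2K_2$ is a vertex adjacent to all four vertices of two disjoint edges. $\chi$ is the chromatic number and $\omega$ the clique number. -}

module Defs where

open import Data.Nat using (ℕ; zero; suc; _≤_)
open import Data.Fin using (Fin; zero; suc; toℕ)
open import Data.Bool using (Bool; true; false)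
open import Data.List using (List; []; _∷_)
open import Data.Product using (Σ; ∃; _×_; _,_)
open import Relation.Nullary using (¬_)
open import Relation.Binary.PropositionalEquality using (_≡_; _≢_)
open import Function.Definitions using (Injective)

record Graph : Set where
  field
    n     : ℕ
    adj   : Fin n → Fin n → Bool
    sym   : ∀ u v → adj u v ≡ adj v u
    irrefl : ∀ v → adj v v ≡ false
open Graph public

data Walk (G : Graph) : Fin (n G) → Fin (n G) → Set where
  here : ∀ {u} → Walk G u u
  step : ∀ {u v w} → adj G u v ≡ true → Walk G v w → Walk G u w

Connected : Graph → Set
Connected G = ∀ u v → Walk G u v

InducedCopy : Graph → Graph → Set
InducedCopy H G =
  Σ (Fin (n H) → Fin (n G)) λ f →
    Injective _≡_ _≡_ f × (∀ i j → adj G (f i) (f j) ≡ adj H i j)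

Free : Graph → Graph → Set
Free H G = ¬ InducedCopy H G

Clique : Graph → ℕ → Set
Clique G k =
  Σ (Fin k → Fin (n G)) λ f →
    Injective _≡_ _≡_ f × (∀ i j → i ≢ j → adj G (f i) (f j) ≡ true)

CliqueNumber : Graph → ℕ → Set
CliqueNumber G w = Clique G w × (∀ k → Clique G k → k ≤ w)

ProperColouring : Graph → ℕ → Set
ProperColouring G k =
  Σ (Fin (n G) → Fin k) λ c → ∀ u v → adj G u v ≡ true → c u ≢ c v

p5adj : Fin 5 → Fin 5 → Bool
p5adj zero (suc zero) = true
p5adj (suc zero) zero = true
p5adj (suc zero) (suc (suc zero)) = true
p5adj (suc (suc zero)) (suc zero) = true
p5adj (suc (suc zero)) (suc (suc (suc zero))) = true
p5adj (suc (suc (suc zero))) (suc (suc zero)) = true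
p5adj (suc (suc (suc zero))) (suc (suc (suc (suc zero)))) = true
p5adj (suc (suc (suc (suc zero)))) (suc (suc (suc zero))) = true
p5adj _ _ = false

-- K1 + 2K2: vertex 0 joined to all of 1,2,3,4; edges 1-2 and 3-4.
k1-2k2adj : Fin 5 → Fin 5 → Bool
k1-2k2adj zero zero = false
k1-2k2adj zero (suc _) = true
k1-2k2adj (suc _) zero = true
k1-2k2adj (suc zero) (suc (suc zero)) = true
k1-2k2adj (suc (suc zero)) (suc zero) = true
k1-2k2adj (suc (suc (suc zero))) (suc (suc (suc (suc zero)))) = true
k1-2k2adj (suc (suc (suc (suc zero)))) (suc (suc (suc zero))) = true
k1-2k2adj _ _ = false

open import Relation.Binary.PropositionalEquality using (refl)

P5 : Graph
P5 = record { n = 5 ; adj = p5adj ; sym = s ; irrefl = ir }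
  where
  s : ∀ u v → p5adj u v ≡ p5adj v u
  s zero zero = refl
  s zero (suc zero) = refl
  s zero (suc (suc zero)) = refl
  s zero (suc (suc (suc zero))) = refl
  s zero (suc (suc (suc (suc zero)))) = refl
  s (suc zero) zero = refl
  s (suc zero) (suc zero) = refl
  s (suc zero) (suc (suc zero)) = refl
  s (suc zero) (suc (suc (suc zero))) = refl
  s (suc zero) (suc (suc (suc (suc zero)))) = refl
  s (suc (suc zero)) zero = refl
  s (suc (suc zero)) (suc zero) = refl
  s (suc (suc zero)) (suc (suc zero)) = refl
  s (suc (suc zero)) (suc (suc (suc zero))) = refl
  s (suc (suc zero)) (suc (suc (suc (suc zero)))) = refl
  s (suc (suc (suc zero))) zero = refl
  s (suc (suc (suc zero))) (suc zero) = refl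
  s (suc (suc (suc zero))) (suc (suc zero)) = refl
  s (suc (suc (suc zero))) (suc (suc (suc zero))) = refl
  s (suc (suc (suc zero))) (suc (suc (suc (suc zero)))) = refl
  s (suc (suc (suc (suc zero)))) zero = refl
  s (suc (suc (suc (suc zero)))) (suc zero) = refl
  s (suc (suc (suc (suc zero)))) (suc (suc zero)) = refl
  s (suc (suc (suc (suc zero)))) (suc (suc (suc zero))) = refl
  s (suc (suc (suc (suc zero)))) (suc (suc (suc (suc zero)))) = refl
  ir : ∀ v → p5adj v v ≡ false
  ir zero = refl
  ir (suc zero) = refl
  ir (suc (suc zero)) = refl
  ir (suc (suc (suc zero))) = refl
  ir (suc (suc (suc (suc zero)))) = refl

K1+2K2 : Graph
K1+2K2 = record { n = 5 ; adj = k1-2k2adj ; sym = s ; irrefl = ir }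
  where
  s : ∀ u v → k1-2k2adj u v ≡ k1-2k2adj v u
  s zero zero = refl
  s zero (suc zero) = refl
  s zero (suc (suc zero)) = refl
  s zero (suc (suc (suc zero))) = refl
  s zero (suc (suc (suc (suc zero)))) = refl
  s (suc zero) zero = refl
  s (suc zero) (suc zero) = refl
  s (suc zero) (suc (suc zero)) = refl
  s (suc zero) (suc (suc (suc zero))) = refl
  s (suc zero) (suc (suc (suc (suc zero)))) = refl
  s (suc (suc zero)) zero = refl
  s (suc (suc zero)) (suc zero) = refl
  s (suc (suc zero)) (suc (suc zero)) = refl
  s (suc (suc zero)) (suc (suc (suc zero))) = refl
  s (suc (suc zero)) (suc (suc (suc (suc zero)))) = refl
  s (suc (suc (suc zero))) zero = refl
  s (suc (suc (suc zero))) (suc zero) = refl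
  s (suc (suc (suc zero))) (suc (suc zero)) = refl
  s (suc (suc (suc zero))) (suc (suc (suc zero))) = refl
  s (suc (suc (suc zero))) (suc (suc (suc (suc zero)))) = refl
  s (suc (suc (suc (suc zero)))) zero = refl
  s (suc (suc (suc (suc zero)))) (suc zero) = refl
  s (suc (suc (suc (suc zero)))) (suc (suc zero)) = refl
  s (suc (suc (suc (suc zero)))) (suc (suc (suc zero))) = refl
  s (suc (suc (suc (suc zero)))) (suc (suc (suc (suc zero)))) = refl
  ir : ∀ v → k1-2k2adj v v ≡ false
  ir zero = refl
  ir (suc zero) = refl
  ir (suc (suc zero)) = refl
  ir (suc (suc (suc zero))) = refl
  ir (suc (suc (suc (suc zero)))) = refl

-- Let Q be a maximum clique, of size ω ≥ 2. A vertex x with a neighbour in Q also misses a vertex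
-- of Q, so going around Q cyclically some non-neighbour a of x is preceded by a neighbour. Colour x
-- by a and a second non-neighbour (or the predecessor of a if a is its only one): ω(ω − 1) colours,
-- properly because Q is maximum and the predecessor of a would otherwise centre an induced K₁+2K₂.
-- In a P₅-free graph adjacent vertices with no neighbour in Q have the same neighbours among the
-- vertices near Q, and by connectivity every such vertex has one. So such a vertex can be coloured inside the
-- neighbourhood of its least near neighbour d, which is 2K₂-free with clique number below ω; Wagon's
-- bound χ ≤ C(ω' + 1, 2) for 2K₂-free graphs gives C(ω, 2) further colours, (3/2)(ω² − ω) in all.

module Submission where

open import Defs hiding (sym)
open import Data.Bool using (Bool; true; false)
open import Data.Bool.Properties using (¬-not) renaming (_≟_ to _≟ᵇ_)
open import Data.Empty using (⊥; ⊥-elim)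
open import Data.Fin
  using (Fin; zero; suc; toℕ; fromℕ; fromℕ<; inject₁; inject≤; punchIn; punchOut; combine; _↑ˡ_; _↑ʳ_; splitAt)
open import Data.Fin.Induction using (<-weakInduction; <-weakInduction-startingFrom)
open import Data.Fin.Patterns using (0F; 1F; 2F; 3F; 4F)
open import Data.Fin.Properties
  using (all?; any?; ¬∀⟶∃¬; toℕ-injective; toℕ<n; toℕ-fromℕ<; toℕ-inject₁; ≤fromℕ; suc-injective;
         punchIn-injective; punchInᵢ≢i; punchOut-injective; combine-injective; inject≤-injective;
         ↑ˡ-injective; ↑ʳ-injective; splitAt-↑ˡ; splitAt-↑ʳ)
  renaming (_≟_ to _≟ᶠ_)
open import Data.Nat using (ℕ; zero; suc; _+_; _*_; _∸_; _≤_; _<_; z≤n; s≤s)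
open import Data.Nat.Properties
  using (≤-refl; <⇒≤; ≤-reflexive; ≤-trans; <-≤-trans; <-cmp; <⇒≢; 1+n≰n; 1+n≢n; m≤m+n; m≤n⇒m≤1+n;
         +-comm; +-mono-≤; +-monoʳ-<; +-cancelˡ-≡; *-suc; *-distribˡ-+; m+n∸m≡n)
open import Data.Nat.Tactic.RingSolver using (solve-∀)
open import Data.Product using (∃; _×_; _,_; proj₁; proj₂)
import Data.Product as Product
open import Data.Sum using (_⊎_; inj₁; inj₂)
open import Data.Unit using (tt)
open import Data.Vec.Functional using ([]; _∷_)
open import Function using (_∘_; id)
open import Level using (0ℓ)
open import Relation.Binary.Definitions using (tri<; tri≈; tri>)
open import Relation.Binary.PropositionalEquality
  using (_≡_; _≢_; refl; sym; trans; cong; subst; module ≡-Reasoning)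
open import Relation.Nullary using (¬_; Dec; yes; no; ¬?; contradiction)
open import Relation.Nullary.Decidable
  using (toWitness; map′; decidable-stable; _×-dec_; _⊎-dec_; _→-dec_)
open import Relation.Unary using (Pred; Decidable; U; ∁; _∩_; _⊆_)
open import Relation.Unary.Properties using (_∩?_)

private
  variable
    a b a′ b′ k l m s : ℕ

triangle : ℕ → ℕ
triangle zero = 0
triangle (suc n) = n + triangle n

triangle-mono : m ≤ k → triangle m ≤ triangle k
triangle-mono z≤n = z≤n
triangle-mono (s≤s m≤k) = +-mono-≤ m≤k (triangle-mono m≤k)

triangle-double : ∀ n → 2 * triangle (suc n) ≡ suc n * n
triangle-double zero = refl
triangle-double (suc n) = begin
  2 * (suc n + triangle (suc n))       ≡⟨ *-distribˡ-+ 2 (suc n) _ ⟩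
  2 * suc n + 2 * triangle (suc n)     ≡⟨ cong (2 * suc n +_) (triangle-double n) ⟩
  2 * suc n + suc n * n                ≡⟨ expand n ⟩
  suc (suc n) * suc n                  ∎
  where
  open ≡-Reasoning
  expand : ∀ n → 2 * suc n + suc n * n ≡ suc (suc n) * suc n
  expand = solve-∀

-- The pairs a < b are enumerated row by row: row b starts at triangle b.
pairCode< : a < b → triangle b + a < triangle (suc b)
pairCode< {a} {b} a<b = subst (triangle b + a <_) (+-comm (triangle b) b) (+-monoʳ-< (triangle b) a<b)

pairCode-row< : a < b → b < b′ → triangle b + a < triangle b′ + a′
pairCode-row< {a′ = a′} a<b b<b′ = <-≤-trans (pairCode< a<b) (≤-trans (triangle-mono b<b′) (m≤m+n _ a′))

pairCode-injective : a < b → a′ < b′ → triangle b + a ≡ triangle b′ + a′ → b ≡ b′ × a ≡ a′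
pairCode-injective {a} {b} {a′} {b′} a<b a′<b′ eq with <-cmp b b′
... | tri< b<b′ _ _ = contradiction eq (<⇒≢ (pairCode-row< a<b b<b′))
... | tri≈ _ refl _ = refl , +-cancelˡ-≡ (triangle b) a a′ eq
... | tri> _ _ b′<b = contradiction (sym eq) (<⇒≢ (pairCode-row< a′<b′ b′<b))

pairIndex : a < b → b ≤ k → Fin (triangle (suc k))
pairIndex a<b b≤k = fromℕ< (<-≤-trans (pairCode< a<b) (triangle-mono (s≤s b≤k)))

pairIndex-injective : (p : a < b) (q : b ≤ k) (p′ : a′ < b′) (q′ : b′ ≤ k) →
                      pairIndex p q ≡ pairIndex p′ q′ → b ≡ b′ × a ≡ a′
pairIndex-injective p _ p′ _ eq =
  pairCode-injective p p′ (trans (sym (toℕ-fromℕ< _)) (trans (cong toℕ eq) (toℕ-fromℕ< _)))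

cyclicPred : Fin (suc m) → Fin (suc m)
cyclicPred zero = fromℕ _
cyclicPred (suc i) = inject₁ i

cyclicPred-≢ : (i : Fin (suc (suc m))) → i ≢ cyclicPred i
cyclicPred-≢ zero ()
cyclicPred-≢ (suc i) eq = 1+n≢n (trans (cong toℕ eq) (toℕ-inject₁ i))

-- If P held at the cyclic predecessor of each of its points, then ¬ P would
-- spread upwards from j, wrap around through the last element, and cover i.
cyclic-boundary : ∀ {ℓ} {P : Pred (Fin (suc m)) ℓ} → Decidable P → ∀ {i j} → P i → ¬ P j →
                  ∃ λ a → P a × ¬ P (cyclicPred a)
cyclic-boundary {P = P} P? {i} {j} pi ¬pj with any? (λ a → P? a ×-dec ¬? (P? (cyclicPred a)))
... | yes boundary = boundary
... | no no-boundary = contradiction pi (¬P-everywhere i)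
  where
  closed : ∀ a → P a → P (cyclicPred a)
  closed a pa = decidable-stable (P? _) λ ¬p → no-boundary (a , pa , ¬p)
  ¬P-step : ∀ a → ¬ P (inject₁ a) → ¬ P (suc a)
  ¬P-step a ¬p p = ¬p (closed (suc a) p)
  ¬P-last : ¬ P (fromℕ _)
  ¬P-last = <-weakInduction-startingFrom (¬_ ∘ P) ¬pj ¬P-step (≤fromℕ j)
  ¬P-everywhere : ∀ a → ¬ P a
  ¬P-everywhere = <-weakInduction (¬_ ∘ P) (¬P-last ∘ closed zero) ¬P-step

least : ∀ {ℓ} {P : Pred (Fin k) ℓ} → Decidable P → ∃ P → ∃ P
least {suc k} P? (i , pi) with P? zero
least P? _ | yes p0 = zero , p0
least P? (zero , p0) | no ¬p0 = contradiction p0 ¬p0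
least P? (suc i , pi) | no _ = Product.map suc id (least (P? ∘ suc) (i , pi))

least-cong : ∀ {ℓ} {P Q : Pred (Fin k) ℓ} (P? : Decidable P) (Q? : Decidable Q) →
             P ⊆ Q → Q ⊆ P → (wp : ∃ P) (wq : ∃ Q) → proj₁ (least P? wp) ≡ proj₁ (least Q? wq)
least-cong {suc k} P? Q? P⊆Q Q⊆P wp wq with P? zero | Q? zero
... | yes _ | yes _ = refl
... | yes p | no ¬q = contradiction (P⊆Q p) ¬q
... | no ¬p | yes q = contradiction (Q⊆P q) ¬p
least-cong P? Q? _ _ (zero , p) _ | no ¬p | no _ = contradiction p ¬p
least-cong P? Q? _ _ _ (zero , q) | no _ | no ¬q = contradiction q ¬q
least-cong P? Q? P⊆Q Q⊆P (suc i , p) (suc j , q) | no _ | no _ =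
  cong suc (least-cong (P? ∘ suc) (Q? ∘ suc) P⊆Q Q⊆P (i , p) (j , q))

-- Makes every map preserving adjacency and non-adjacency injective.
Separating : Graph → Set
Separating H = ∀ i j → i ≢ j → adj H i j ≡ true ⊎ ∃ λ k → adj H i k ≢ adj H j k

separating? : ∀ H → Dec (Separating H)
separating? H = all? λ i → all? λ j →
  ¬? (i ≟ᶠ j) →-dec ((adj H i j ≟ᵇ true) ⊎-dec any? λ k → ¬? (adj H i k ≟ᵇ adj H j k))

P5-separating : Separating P5
P5-separating = toWitness {a? = separating? P5} tt

K1+2K2-separating : Separating K1+2K2
K1+2K2-separating = toWitness {a? = separating? K1+2K2} tt

module _ (G : Graph) where

  V : Set
  V = Fin (n G)

  infix 4 _~_
  _~_ : V → V → Set
  x ~ y = adj G x y ≡ true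

  private
    variable
      x y d : V

  ~-sym : x ~ y → y ~ x
  ~-sym {x} {y} x~y = trans (Graph.sym G y x) x~y

  ~-irrefl : ¬ x ~ x
  ~-irrefl {x} x~x = contradiction (trans (sym x~x) (irrefl G x)) λ ()

  _~?_ : ∀ x y → Dec (x ~ y)
  x ~? y = adj G x y ≟ᵇ true

  inducedCopy : (H : Graph) → Separating H → (f : Fin (n H) → V) →
                (∀ i j → adj G (f i) (f j) ≡ adj H i j) → InducedCopy H G
  inducedCopy H separating f preserves = f , injective , preserves
    where
    injective : ∀ {i j} → f i ≡ f j → i ≡ j
    injective {i} {j} fi≡fj with i ≟ᶠ j
    ... | yes i≡j = i≡j
    ... | no i≢j with separating i j i≢j
    ... | inj₁ i~j = ⊥-elim (~-irrefl (subst (f i ~_) (sym fi≡fj) (trans (preserves i j) i~j)))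
    ... | inj₂ (k , distinguishes) = contradiction
          (trans (sym (preserves i k)) (trans (cong (λ v → adj G v (f k)) fi≡fj) (preserves j k))) distinguishes

  fromUpperTriangle : (H : Graph) (f : Fin (n H) → V) →
                      (∀ {i j} → toℕ i < toℕ j → adj G (f i) (f j) ≡ adj H i j) →
                      ∀ i j → adj G (f i) (f j) ≡ adj H i j
  fromUpperTriangle H f upper i j with <-cmp (toℕ i) (toℕ j)
  ... | tri< i<j _ _ = upper i<j
  ... | tri≈ _ i≡j _ rewrite toℕ-injective i≡j = trans (irrefl G (f j)) (sym (irrefl H j))
  ... | tri> _ _ j<i = trans (Graph.sym G (f i) (f j)) (trans (upper j<i) (Graph.sym H j i))

  module _ (h : Fin 5 → Fin 5 → Bool) {v₀ v₁ v₂ v₃ v₄ : V}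
           (e₀₁ : adj G v₀ v₁ ≡ h 0F 1F) (e₀₂ : adj G v₀ v₂ ≡ h 0F 2F) (e₀₃ : adj G v₀ v₃ ≡ h 0F 3F)
           (e₀₄ : adj G v₀ v₄ ≡ h 0F 4F) (e₁₂ : adj G v₁ v₂ ≡ h 1F 2F) (e₁₃ : adj G v₁ v₃ ≡ h 1F 3F)
           (e₁₄ : adj G v₁ v₄ ≡ h 1F 4F) (e₂₃ : adj G v₂ v₃ ≡ h 2F 3F) (e₂₄ : adj G v₂ v₄ ≡ h 2F 4F)
           (e₃₄ : adj G v₃ v₄ ≡ h 3F 4F) where

    fiveVertices-upper : ∀ {i j} → toℕ i < toℕ j →
                         let v = v₀ ∷ v₁ ∷ v₂ ∷ v₃ ∷ v₄ ∷ [] in adj G (v i) (v j) ≡ h i j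
    fiveVertices-upper {0F} {1F} _ = e₀₁
    fiveVertices-upper {0F} {2F} _ = e₀₂
    fiveVertices-upper {0F} {3F} _ = e₀₃
    fiveVertices-upper {0F} {4F} _ = e₀₄
    fiveVertices-upper {1F} {2F} _ = e₁₂
    fiveVertices-upper {1F} {3F} _ = e₁₃
    fiveVertices-upper {1F} {4F} _ = e₁₄
    fiveVertices-upper {2F} {3F} _ = e₂₃
    fiveVertices-upper {2F} {4F} _ = e₂₄
    fiveVertices-upper {3F} {4F} _ = e₃₄
    fiveVertices-upper {j = 0F} ()
    fiveVertices-upper {suc _} {1F} (s≤s ())
    fiveVertices-upper {suc (suc _)} {2F} (s≤s (s≤s ()))
    fiveVertices-upper {suc (suc (suc _))} {3F} (s≤s (s≤s (s≤s ())))
    fiveVertices-upper {suc (suc (suc (suc _)))} {4F} (s≤s (s≤s (s≤s (s≤s ()))))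

  no-induced-P5 : Free P5 G → ∀ {p₀ p₁ p₂ p₃ p₄} →
                  p₀ ~ p₁ → p₁ ~ p₂ → p₂ ~ p₃ → p₃ ~ p₄ →
                  ¬ p₀ ~ p₂ → ¬ p₀ ~ p₃ → ¬ p₀ ~ p₄ → ¬ p₁ ~ p₃ → ¬ p₁ ~ p₄ → ¬ p₂ ~ p₄ → ⊥
  no-induced-P5 P5-free e₀₁ e₁₂ e₂₃ e₃₄ n₀₂ n₀₃ n₀₄ n₁₃ n₁₄ n₂₄ =
    P5-free (inducedCopy P5 P5-separating _ (fromUpperTriangle P5 _
      (fiveVertices-upper (adj P5) e₀₁ (¬-not n₀₂) (¬-not n₀₃) (¬-not n₀₄)
                                   e₁₂ (¬-not n₁₃) (¬-not n₁₄) e₂₃ (¬-not n₂₄) e₃₄)))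

  no-induced-K1+2K2 : Free K1+2K2 G → ∀ {c x₁ x₂ y₁ y₂} →
                      c ~ x₁ → c ~ x₂ → c ~ y₁ → c ~ y₂ → x₁ ~ x₂ → y₁ ~ y₂ →
                      ¬ x₁ ~ y₁ → ¬ x₁ ~ y₂ → ¬ x₂ ~ y₁ → ¬ x₂ ~ y₂ → ⊥
  no-induced-K1+2K2 K1+2K2-free e₀₁ e₀₂ e₀₃ e₀₄ e₁₂ e₃₄ n₁₃ n₁₄ n₂₃ n₂₄ =
    K1+2K2-free (inducedCopy K1+2K2 K1+2K2-separating _ (fromUpperTriangle K1+2K2 _
      (fiveVertices-upper (adj K1+2K2) e₀₁ e₀₂ e₀₃ e₀₄
                                       e₁₂ (¬-not n₁₃) (¬-not n₁₄) (¬-not n₂₃) (¬-not n₂₄) e₃₄)))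

  record CliqueIn (P : Pred V 0ℓ) (k : ℕ) : Set where
    field
      vertex   : Fin k → V
      adjacent : ∀ i j → i ≢ j → vertex i ~ vertex j
      inside   : ∀ i → P (vertex i)
  open CliqueIn

  private
    variable
      P : Pred V 0ℓ

  fromClique : Clique G k → CliqueIn U k
  fromClique (f , _ , f-adjacent) = record { vertex = f ; adjacent = f-adjacent ; inside = λ _ → tt }

  toClique : CliqueIn P k → Clique G k
  toClique K = vertex K , injective , adjacent K
    where
    injective : ∀ {i j} → vertex K i ≡ vertex K j → i ≡ j
    injective {i} {j} vi≡vj with i ≟ᶠ j
    ... | yes i≡j = i≡j
    ... | no i≢j = contradiction (subst (vertex K i ~_) (sym vi≡vj) (adjacent K i j i≢j)) ~-irrefl

  CliqueIn-empty : CliqueIn P 0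
  CliqueIn-empty = record { vertex = λ () ; adjacent = λ () ; inside = λ () }

  CliqueIn-mono : ∀ {Q} → P ⊆ Q → CliqueIn P k → CliqueIn Q k
  CliqueIn-mono P⊆Q K = record { vertex = vertex K ; adjacent = adjacent K ; inside = P⊆Q ∘ inside K }

  CliqueIn-cons : (K : CliqueIn P k) → P x → (∀ i → x ~ vertex K i) → CliqueIn P (suc k)
  CliqueIn-cons {x = x} K px x~K = record
    { vertex = x ∷ vertex K ; adjacent = adjacent′ ; inside = λ { zero → px ; (suc i) → inside K i } }
    where
    adjacent′ : ∀ i j → i ≢ j → (x ∷ vertex K) i ~ (x ∷ vertex K) j
    adjacent′ zero zero 0≢0 = contradiction refl 0≢0
    adjacent′ zero (suc j) _ = x~K j
    adjacent′ (suc i) zero _ = ~-sym (x~K i)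
    adjacent′ (suc i) (suc j) i≢j = adjacent K i j (i≢j ∘ cong suc)

  CliqueIn-remove : CliqueIn P (suc k) → Fin (suc k) → CliqueIn P k
  CliqueIn-remove K i = record
    { vertex = vertex K ∘ punchIn i
    ; adjacent = λ j j′ j≢j′ → adjacent K _ _ (j≢j′ ∘ punchIn-injective i j j′)
    ; inside = inside K ∘ punchIn i
    }

  AdjacentExcept : V → (Fin k → V) → Fin k → Set
  AdjacentExcept x f i = ∀ j → j ≢ i → x ~ f j

  adjacentExcept⊎nonNeighbour : ∀ x (f : Fin k → V) i → AdjacentExcept x f i ⊎ ∃ λ j → j ≢ i × ¬ x ~ f j
  adjacentExcept⊎nonNeighbour x f i with any? (λ j → ¬? (j ≟ᶠ i) ×-dec ¬? (x ~? f j))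
  ... | yes another = inj₂ another
  ... | no none = inj₁ λ j j≢i → decidable-stable (x ~? f j) λ x≁j → none (j , j≢i , x≁j)

  CliqueIn-exchange : (K : CliqueIn P k) (i : Fin k) → P x → P y → x ~ y →
                      AdjacentExcept x (vertex K) i → AdjacentExcept y (vertex K) i → CliqueIn P (suc k)
  CliqueIn-exchange {k = suc _} {x = x} {y = y} K i px py x~y x~K y~K =
    CliqueIn-cons (CliqueIn-cons K∖i px (λ j → x~K _ (punchInᵢ≢i i j))) py y~x∷K∖i
    where
    K∖i = CliqueIn-remove K i
    y~x∷K∖i : ∀ j → y ~ (x ∷ vertex K∖i) j
    y~x∷K∖i zero = ~-sym x~y
    y~x∷K∖i (suc j) = y~K _ (punchInᵢ≢i i j)

  cliqueIn? : Decidable P → ∀ k → Dec (CliqueIn P k)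
  cliqueIn? P? zero = yes CliqueIn-empty
  cliqueIn? {P} P? (suc k) =
    map′ (λ (x , px , K) → CliqueIn-cons (CliqueIn-mono proj₁ K) px (proj₂ ∘ inside K)) uncons
         (any? λ x → P? x ×-dec cliqueIn? (P? ∩? (x ~?_)) k)
    where
    uncons : CliqueIn P (suc k) → ∃ λ x → P x × CliqueIn (P ∩ (x ~_)) k
    uncons K = vertex K zero , inside K zero , record
      { vertex = vertex K ∘ suc
      ; adjacent = λ i j i≢j → adjacent K (suc i) (suc j) (i≢j ∘ suc-injective)
      ; inside = λ i → inside K (suc i) , adjacent K zero (suc i) λ ()
      }

  maximumCliqueIn : Decidable P → ¬ CliqueIn P (suc s) →
                    ∃ λ k → k ≤ s × CliqueIn P k × ¬ CliqueIn P (suc k)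
  maximumCliqueIn {s = s} P? none with cliqueIn? P? s
  ... | yes K = s , ≤-refl , K , none
  maximumCliqueIn {s = zero} P? _ | no ¬K = contradiction CliqueIn-empty ¬K
  maximumCliqueIn {s = suc s} P? _ | no ¬K with maximumCliqueIn P? ¬K
  ... | k , k≤s , K , K-maximum = k , m≤n⇒m≤1+n k≤s , K , K-maximum

  nonNeighbour : (K : CliqueIn P k) → ¬ CliqueIn P (suc k) → P x → ∃ λ i → ¬ x ~ vertex K i
  nonNeighbour {k = k} {x = x} K K-maximum px =
    ¬∀⟶∃¬ k _ (λ i → x ~? vertex K i) (K-maximum ∘ CliqueIn-cons K px)

  record ColouringOn (S : Pred V 0ℓ) (k : ℕ) : Set where
    field
      colour : ∀ x → S x → Fin k
      proper : ∀ {x y} (sx : S x) (sy : S y) → x ~ y → colour x sx ≢ colour y sy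

  ColouringOn-weaken : k ≤ l → ColouringOn P k → ColouringOn P l
  ColouringOn-weaken k≤l C = record
    { colour = λ x px → inject≤ (colour x px) k≤l
    ; proper = λ px py x~y → proper px py x~y ∘ inject≤-injective k≤l k≤l _ _
    }
    where open ColouringOn C

  ColouringOn-dispatch : (C : ∀ d → ColouringOn (d ~_) k) (δ : ∀ x → P x → V) →
                         (∀ x px → δ x px ~ x) → (∀ {x y} px py → x ~ y → δ x px ≡ δ y py) →
                         ColouringOn P k
  ColouringOn-dispatch C δ δ~ δ-edge = record
    { colour = λ x px → ColouringOn.colour (C (δ x px)) x (δ~ x px)
    ; proper = λ {x} {y} px py x~y → proper-at x~y (δ-edge px py x~y) (δ~ x px) (δ~ y py)
    }
    where
    proper-at : ∀ {d d′ x y} → x ~ y → d ≡ d′ → (dx : d ~ x) (dy : d′ ~ y) →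
                ColouringOn.colour (C d) x dx ≢ ColouringOn.colour (C d′) y dy
    proper-at x~y refl dx dy = ColouringOn.proper (C _) dx dy x~y

  ColouringOn-split : Decidable P → ColouringOn P k → ColouringOn (∁ P) l → ProperColouring G (k + l)
  ColouringOn-split {k = k} {l = l} P? C D = colour , proper
    where
    module C = ColouringOn C
    module D = ColouringOn D
    colour : V → Fin (k + l)
    colour x with P? x
    ... | yes px = C.colour x px ↑ˡ l
    ... | no ¬px = k ↑ʳ D.colour x ¬px
    ↑ˡ≢↑ʳ : ∀ {i j} → i ↑ˡ l ≢ k ↑ʳ j
    ↑ˡ≢↑ʳ {i} {j} eq with () ← trans (sym (splitAt-↑ˡ k i l)) (trans (cong (splitAt k) eq) (splitAt-↑ʳ k l j))
    proper : ∀ x y → x ~ y → colour x ≢ colour y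
    proper x y x~y with P? x | P? y
    ... | yes px | yes py = C.proper px py x~y ∘ ↑ˡ-injective l _ _
    ... | yes _ | no _ = ↑ˡ≢↑ʳ
    ... | no _ | yes _ = ↑ˡ≢↑ʳ ∘ sym
    ... | no ¬px | no ¬py = D.proper ¬px ¬py x~y ∘ ↑ʳ-injective k _ _

  2K2-freeOn : Pred V 0ℓ → Set
  2K2-freeOn P = ∀ {x₁ x₂ y₁ y₂} → P x₁ → P x₂ → P y₁ → P y₂ → x₁ ~ x₂ → y₁ ~ y₂ →
                 ¬ x₁ ~ y₁ → ¬ x₁ ~ y₂ → ¬ x₂ ~ y₁ → ¬ x₂ ~ y₂ → ⊥

  neighbourhood-2K2-free : Free K1+2K2 G → ∀ d → 2K2-freeOn (d ~_)
  neighbourhood-2K2-free K1+2K2-free d dx₁ dx₂ dy₁ dy₂ =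
    no-induced-K1+2K2 K1+2K2-free dx₁ dx₂ dy₁ dy₂

  -- Each x ∈ P misses a vertex of the maximum clique K; it is labelled by two of its
  -- non-neighbours i < j, or by (i, k) if i is its only one.
  module Wagon (P-2K2-free : 2K2-freeOn P) (K : CliqueIn P k) (K-maximum : ¬ CliqueIn P (suc k)) where

    data Label (x : V) : Set where
      single : (i : Fin k) → AdjacentExcept x (vertex K) i → Label x
      pair   : (i j : Fin k) → toℕ i < toℕ j → ¬ x ~ vertex K i → ¬ x ~ vertex K j → Label x

    label : P x → Label x
    label {x} px with nonNeighbour K K-maximum px
    ... | i , x≁i with adjacentExcept⊎nonNeighbour x (vertex K) i
    ... | inj₁ x~K = single i x~K
    ... | inj₂ (j , j≢i , x≁j) with <-cmp (toℕ i) (toℕ j)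
    ... | tri< i<j _ _ = pair i j i<j x≁i x≁j
    ... | tri≈ _ i≡j _ = contradiction (toℕ-injective (sym i≡j)) j≢i
    ... | tri> _ _ j<i = pair j i j<i x≁j x≁i

    lo hi : Label x → ℕ
    lo (single i _) = toℕ i
    lo (pair i _ _ _ _) = toℕ i
    hi (single _ _) = k
    hi (pair _ j _ _ _) = toℕ j

    lo<hi : (l : Label x) → lo l < hi l
    lo<hi (single i _) = toℕ<n i
    lo<hi (pair _ _ i<j _ _) = i<j

    hi≤k : (l : Label x) → hi l ≤ k
    hi≤k (single _ _) = ≤-refl
    hi≤k (pair _ j _ _ _) = <⇒≤ (toℕ<n j)

    adjacent-labels-differ : P x → P y → x ~ y → (l : Label x) (l′ : Label y) →
                             hi l ≡ hi l′ → lo l ≡ lo l′ → ⊥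
    adjacent-labels-differ px py x~y (single i x~K) (single i′ y~K) _ lo≡ with toℕ-injective lo≡
    ... | refl = K-maximum (CliqueIn-exchange K i px py x~y x~K y~K)
    adjacent-labels-differ _ _ _ (single _ _) (pair _ j _ _ _) hi≡ _ = <⇒≢ (toℕ<n j) (sym hi≡)
    adjacent-labels-differ _ _ _ (pair _ j _ _ _) (single _ _) hi≡ _ = <⇒≢ (toℕ<n j) hi≡
    adjacent-labels-differ px py x~y (pair i j i<j x≁i x≁j) (pair _ _ _ y≁i y≁j) hi≡ lo≡
      with toℕ-injective hi≡ | toℕ-injective lo≡
    ... | refl | refl = P-2K2-free px py (inside K i) (inside K j) x~y
                          (adjacent K i j (<⇒≢ i<j ∘ cong toℕ)) x≁i x≁j y≁i y≁j

    index : Label x → Fin (triangle (suc k))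
    index l = pairIndex (lo<hi l) (hi≤k l)

    index-injective : (l : Label x) (l′ : Label y) → index l ≡ index l′ → hi l ≡ hi l′ × lo l ≡ lo l′
    index-injective l l′ = pairIndex-injective (lo<hi l) (hi≤k l) (lo<hi l′) (hi≤k l′)

    colouring : ColouringOn P (triangle (suc k))
    colouring = record
      { colour = λ x px → index (label px)
      ; proper = λ px py x~y eq →
          let hi≡ , lo≡ = index-injective (label px) (label py) eq
          in adjacent-labels-differ px py x~y (label px) (label py) hi≡ lo≡
      }

  wagon : Decidable P → 2K2-freeOn P → ¬ CliqueIn P (suc s) → ColouringOn P (triangle (suc s))
  wagon P? P-2K2-free no-larger with maximumCliqueIn P? no-larger
  ... | k , k≤s , K , K-maximum =
    ColouringOn-weaken (triangle-mono (s≤s k≤s)) (Wagon.colouring P-2K2-free K K-maximum)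

  CliqueIn-cone : CliqueIn (d ~_) k → CliqueIn U (suc k)
  CliqueIn-cone K = CliqueIn-cons (CliqueIn-mono _ K) tt (inside K)

  neighbourhoodColouring : Free K1+2K2 G → ¬ CliqueIn U (suc (suc s)) →
                           ∀ d → ColouringOn (d ~_) (triangle (suc s))
  neighbourhoodColouring K1+2K2-free no-larger d =
    wagon (d ~?_) (neighbourhood-2K2-free K1+2K2-free d) (no-larger ∘ CliqueIn-cone)

  module _ (K1+2K2-free : Free K1+2K2 G) {m} (Q : CliqueIn U (suc (suc m)))
           (Q-maximum : ¬ CliqueIn U (suc (suc (suc m)))) where

    private
      q = vertex Q

    Near : Pred V 0ℓ
    Near x = ∃ λ c → x ~ q c

    near? : Decidable Near
    near? x = any? λ c → x ~? q c

    data NearLabel (x : V) : Set where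
      single : (a : Fin (suc (suc m))) → AdjacentExcept x q a → NearLabel x
      pair   : (a b : Fin (suc (suc m))) → a ≢ b → ¬ x ~ q a → ¬ x ~ q b → x ~ q (cyclicPred a) → NearLabel x

    nearLabel : Near x → NearLabel x
    nearLabel {x} (c , x~c) with nonNeighbour Q Q-maximum tt
    ... | i , x≁i with cyclic-boundary (λ a → ¬? (x ~? q a)) x≁i (λ x≁c → x≁c x~c)
    ... | a , x≁a , ¬x≁pred with adjacentExcept⊎nonNeighbour x q a
    ... | inj₁ x~Q = single a x~Q
    ... | inj₂ (b , b≢a , x≁b) = pair a b (b≢a ∘ sym) x≁a x≁b (decidable-stable (x ~? _) ¬x≁pred)

    first : NearLabel x → Fin (suc (suc m))
    first (single a _) = a
    first (pair a _ _ _ _ _) = a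

    second : NearLabel x → Fin (suc m)
    second (single a _) = punchOut (cyclicPred-≢ a)
    second (pair _ _ a≢b _ _ _) = punchOut a≢b

    adjacent-nearLabels-differ : x ~ y → (l : NearLabel x) (l′ : NearLabel y) →
                                 first l ≡ first l′ → second l ≡ second l′ → ⊥
    adjacent-nearLabels-differ x~y (single a x~Q) (single _ y~Q) refl _ =
      Q-maximum (CliqueIn-exchange Q a tt tt x~y x~Q y~Q)
    adjacent-nearLabels-differ _ (single a _) (pair _ b a≢b _ y≁b y~pred) refl second≡
      with punchOut-injective (cyclicPred-≢ a) a≢b second≡
    ... | refl = y≁b y~pred
    adjacent-nearLabels-differ _ (pair _ b a≢b _ x≁b x~pred) (single a _) refl second≡
      with punchOut-injective a≢b (cyclicPred-≢ a) second≡
    ... | refl = x≁b x~pred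
    adjacent-nearLabels-differ x~y (pair a b a≢b x≁a x≁b x~pred) (pair _ b′ a≢b′ y≁a y≁b y~pred)
                               refl second≡
      with punchOut-injective a≢b a≢b′ second≡
    ... | refl = no-induced-K1+2K2 K1+2K2-free (~-sym x~pred) (~-sym y~pred)
                   (adjacent Q _ _ (cyclicPred-≢ a ∘ sym)) (adjacent Q _ _ λ { refl → x≁b x~pred })
                   x~y (adjacent Q a b a≢b) x≁a x≁b y≁a y≁b

    nearColouring : ColouringOn Near (suc (suc m) * suc m)
    nearColouring = record
      { colour = λ x near → combine (first (nearLabel near)) (second (nearLabel near))
      ; proper = λ nx ny x~y eq →
          let first≡ , second≡ = combine-injective _ _ _ _ eq
          in adjacent-nearLabels-differ x~y (nearLabel nx) (nearLabel ny) first≡ second≡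
      }

    module _ (P5-free : Free P5 G) (connected : Connected G) where

      Far : Pred V 0ℓ
      Far = ∁ Near

      -- Otherwise y x d (q c) (q i), with q i a non-neighbour of d, is an induced P5.
      far-edge-preserves-nearNeighbour : Far x → Far y → x ~ y → Near d → d ~ x → d ~ y
      far-edge-preserves-nearNeighbour {x} {y} {d} far-x far-y x~y (c , d~c) d~x with d ~? y
      ... | yes d~y = d~y
      ... | no d≁y with nonNeighbour Q Q-maximum tt
      ... | i , d≁i = ⊥-elim (no-induced-P5 P5-free
                        (~-sym x~y) (~-sym d~x) d~c (adjacent Q c i λ { refl → d≁i d~c })
                        (d≁y ∘ ~-sym) (far-y ∘ (c ,_)) (far-y ∘ (i ,_))
                        (far-x ∘ (c ,_)) (far-x ∘ (i ,_)) d≁i)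

      NearNeighbour : V → Pred V 0ℓ
      NearNeighbour x d = Near d × d ~ x

      nearNeighbour : Far x → ∃ (NearNeighbour x)
      nearNeighbour far = along (connected _ (q 0F)) (1F , adjacent Q 0F 1F λ ()) far
        where
        along : ∀ {x y} → Walk G x y → Near y → Far x → ∃ (NearNeighbour x)
        along here near far = contradiction near far
        along (step {v = z} x~z walk) near far with near? z
        ... | yes near-z = z , near-z , ~-sym x~z
        ... | no far-z with along walk near far-z
        ... | d , near-d , d~z =
          d , near-d , far-edge-preserves-nearNeighbour far-z far (~-sym x~z) near-d d~z

      -- Taking the least one makes the choice equal for adjacent far vertices.
      anchor : ∀ x → Far x → V
      anchor x far = proj₁ (least (near? ∩? (_~? x)) (nearNeighbour far))

      anchor~ : ∀ x far → anchor x far ~ x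
      anchor~ x far = proj₂ (proj₂ (least (near? ∩? (_~? x)) (nearNeighbour far)))

      anchor-edge : ∀ {x y} far-x far-y → x ~ y → anchor x far-x ≡ anchor y far-y
      anchor-edge far-x far-y x~y = least-cong (near? ∩? _) (near? ∩? _)
        (λ (near , d~x) → near , far-edge-preserves-nearNeighbour far-x far-y x~y near d~x)
        (λ (near , d~y) → near , far-edge-preserves-nearNeighbour far-y far-x (~-sym x~y) near d~y)
        (nearNeighbour far-x) (nearNeighbour far-y)

      farColouring : ColouringOn Far (triangle (suc (suc m)))
      farColouring =
        ColouringOn-dispatch (neighbourhoodColouring K1+2K2-free Q-maximum) anchor anchor~ anchor-edge

      colouring : ProperColouring G (suc (suc m) * suc m + triangle (suc (suc m)))
      colouring = ColouringOn-split near? nearColouring farColouring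

colour-count : ∀ n → 2 * (suc n * n + triangle (suc n)) ≡ 3 * (suc n * suc n ∸ suc n)
colour-count n = begin
  2 * (w * n + triangle w)       ≡⟨ *-distribˡ-+ 2 (w * n) (triangle w) ⟩
  2 * (w * n) + 2 * triangle w   ≡⟨ cong (2 * (w * n) +_) (triangle-double n) ⟩
  2 * (w * n) + w * n            ≡⟨ thrice (w * n) ⟩
  3 * (w * n)                    ≡⟨ cong (3 *_) (sym (m+n∸m≡n w (w * n))) ⟩
  3 * (w + w * n ∸ w)            ≡⟨ cong (λ t → 3 * (t ∸ w)) (sym (*-suc w n)) ⟩
  3 * (w * w ∸ w)                ∎
  where
  open ≡-Reasoning
  w = suc n
  thrice : ∀ t → 2 * t + t ≡ 3 * t
  thrice = solve-∀

theorem1p3 : (G : Graph) (w : ℕ) → CliqueNumber G w → 2 ≤ w → Connected G → Free P5 G → Free K1+2K2 G → ∃ λ k → (2 * k ≤ 3 * (w * w ∸ w)) × ProperColouring G k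
theorem1p3 G (suc (suc m)) (ω-clique , ω-maximum) (s≤s (s≤s z≤n)) connected P5-free K1+2K2-free =
  _ , ≤-reflexive (colour-count (suc m)) ,
  colouring G K1+2K2-free (fromClique G ω-clique) no-larger-clique P5-free connected
  where
  no-larger-clique : ¬ CliqueIn G U (suc (suc (suc m)))
  no-larger-clique K = 1+n≰n (ω-maximum _ (toClique G K))
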